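{- Let $A=\{a_1,\dots,a_\ell\}\subset\mathbb{Z}^d$ be finite such that the lattice $\Lambda_{A-A}$ generated by $A-A$ is $d$-dimensional. If $u \in \mathcal Z^\dagger$ then $\Vert u\Vert_{\infty}=\max_i |u_i| \leqslant \operatorname{Vol}^{\dagger,\max}(H(A))$.
   Context: $\operatorname{wt}(z)=\sum_i z_i$, $\operatorname{supp}(z)=\{i:z_i\neq0\}$, $A_{\operatorname{mat}}$ is the $d\times\ell$ matrix with columns $a_i$. $\mathcal{Z}=\{z\in\mathbb{Z}^\ell:\operatorname{wt}(z)=0,\ A_{\operatorname{mat}}z=0\}$ and $\mathcal{Z}^\dagger=\{u\in\mathcal{Z}\setminus\{0\}: \text{if } v\in\mathcal{Z}\setminus\{0\} \text{ with } \operatorname{supp}(v)\subset\operatorname{supp}(u) \text{ then } v=\lambda u \text{ for some } \lambda\in\mathbb{Z}\}$. $\operatorname{Vol}^{\dagger,\max}(H(A)) := \max |\det ( a_{i_1}-a_{i_0} , \dots , a_{i_{d}}-a_{i_0})|$ over $(d+1)$-element subsets $\{i_0,\dots,i_d\}\subset\{1,\dots,\ell\}$. -}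

module Defs where

open import Data.Nat using (ℕ; zero; suc)
open import Data.Integer using (ℤ; +_; _+_; _*_; -_; _-_; ∣_∣)
open import Data.Fin using (Fin; zero; suc; punchIn)
open import Data.Product using (Σ; ∃; _×_; _,_)
open import Relation.Binary.PropositionalEquality using (_≡_; _≢_)
open import Relation.Nullary using (¬_)
open import Function.Definitions using (Injective)

∑ : ∀ {n} → (Fin n → ℤ) → ℤ
∑ {zero} f = + 0
∑ {suc n} f = f zero + ∑ (λ i → f (suc i))

Pt : ℕ → Set
Pt d = Fin d → ℤ

0ᵥ : ∀ {d} → Pt d
0ᵥ _ = + 0

_-ᵥ_ : ∀ {d} → Pt d → Pt d → Pt d
(x -ᵥ y) k = x k - y k

wt : ∀ {ℓ} → (Fin ℓ → ℤ) → ℤ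
wt z = ∑ z

matVec : ∀ {d ℓ} → (Fin ℓ → Pt d) → (Fin ℓ → ℤ) → Pt d
matVec a z k = ∑ (λ i → z i * a i k)

InZ : ∀ {d ℓ} → (Fin ℓ → Pt d) → (Fin ℓ → ℤ) → Set
InZ a z = wt z ≡ + 0 × (∀ k → matVec a z k ≡ + 0)

SuppSubset : ∀ {ℓ} → (Fin ℓ → ℤ) → (Fin ℓ → ℤ) → Set
SuppSubset v u = ∀ i → v i ≢ + 0 → u i ≢ + 0

NonZeroVec : ∀ {ℓ} → (Fin ℓ → ℤ) → Set
NonZeroVec z = ¬ (∀ i → z i ≡ + 0)

InZdagger : ∀ {d ℓ} → (Fin ℓ → Pt d) → (Fin ℓ → ℤ) → Set
InZdagger a u =
  InZ a u × NonZeroVec u ×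
  (∀ v → InZ a v → NonZeroVec v → SuppSubset v u →
     ∃ λ (λ' : ℤ) → ∀ i → v i ≡ λ' * u i)

InLattice : ∀ {d ℓ} → (Fin ℓ → Pt d) → Pt d → Set
InLattice {ℓ = ℓ} a v =
  ∃ λ (c : Fin ℓ → Fin ℓ → ℤ) →
    ∀ k → v k ≡ ∑ (λ i → ∑ (λ j → c i j * (a i k - a j k)))

LatticeFullDim : ∀ {d ℓ} → (Fin ℓ → Pt d) → Set
LatticeFullDim {d} a =
  ∃ λ (w : Fin d → Pt d) →
    (∀ r → InLattice a (w r)) ×
    (∀ (c : Fin d → ℤ) → (∀ k → ∑ (λ r → c r * w r k) ≡ + 0) → ∀ r → c r ≡ + 0)

sgn : ∀ {n} → Fin n → ℤ
sgn zero = + 1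
sgn (suc i) = - sgn i

det : ∀ {n} → (Fin n → Fin n → ℤ) → ℤ
det {zero} M = + 1
det {suc n} M = ∑ (λ j → sgn j * (M zero j * det (λ r c → M (suc r) (punchIn j c))))

volSimplex : ∀ {d ℓ} → (Fin ℓ → Pt d) → (Fin (suc d) → Fin ℓ) → ℕ
volSimplex a i = ∣ det (λ r c → a (i (suc c)) r - a (i zero) r) ∣

-- n ≤ Vol^{†,max}(H(A)) : the max over (d+1)-element subsets {i_0,…,i_d}
-- (injective indexings) is at least n
_≤Vol†max_ : ∀ {d ℓ} → ℕ → (Fin ℓ → Pt d) → Set
_≤Vol†max_ {d} {ℓ} n a =
  ∃ λ (i : Fin (suc d) → Fin ℓ) → Injective _≡_ _≡_ i × (n Data.Nat.≤ volSimplex a i)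

module Submission where

-- Let H(A) be the (d+1) × ℓ matrix whose columns are the points a_i lifted to height one;
-- 𝒵 is its integer kernel, and full-dimensionality of Λ_{A−A} makes it of rank d+1.  Take
-- d+1 linearly independent columns σ and an index s in supp u outside σ.  The signed maximal
-- minors (cofactors) w of the columns s ∷ σ form a nonzero vector of 𝒵 supported in s ∷ σ,
-- and every |w_p| is the normalized volume of a simplex with vertices in A.  If w is nonzero
-- at some σ c with u (σ c) = 0, exchanging σ c for s keeps the columns independent and puts
-- more of them in supp u.  Otherwise supp w ⊆ supp u, so w = λ u with λ ≠ 0 because u is a
-- circuit, and |u_i| ≤ |w_i| ≤ Vol^{†,max}(H(A)).

open import Defs
open import Data.Nat as ℕ using (ℕ; zero; suc; z≤n)
import Data.Nat.Properties as ℕP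
open import Data.Integer as ℤ using (ℤ; +_; -[1+_]; _+_; _*_; -_; _-_; ∣_∣)
import Data.Integer.Properties as ℤP
open import Data.Integer.Tactic.RingSolver using (solve-∀)
open import Data.Fin as Fin using (Fin; zero; suc; punchIn; fromℕ)
import Data.Fin.Properties as FinP
open import Data.Vec.Functional using (_∷_; updateAt; insertAt; removeAt)
import Data.Vec.Functional.Properties as VecP
import Algebra.Properties.Semiring.Sum ℤP.+-*-semiring as ℤSum
import Algebra.Properties.CommutativeMonoid.Sum ℕP.+-0-commutativeMonoid as ℕSum
open import Algebra.Bundles using (AbelianGroup)
open import Algebra.Properties.Group (AbelianGroup.group ℤP.+-0-abelianGroup) using (∙-cancelˡ)
open import Data.Product using (Σ; ∃; _×_; _,_; proj₁; proj₂)
open import Data.Sum using (_⊎_; inj₁; inj₂; [_,_]′)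
open import Function using (_∘_; const; id)
open import Function.Definitions using (Injective)
open import Relation.Nullary using (Dec; yes; no; ¬?; contradiction)
open import Relation.Nullary.Decidable using (decidable-stable; _×-dec_)
open import Relation.Binary.PropositionalEquality
open import Induction.WellFounded using (Acc; acc)
open import Data.Nat.Induction using (<-wellFounded)

∑-cong : ∀ {n} {f g : Fin n → ℤ} → (∀ i → f i ≡ g i) → ∑ f ≡ ∑ g
∑-cong {zero}  eq = refl
∑-cong {suc n} eq = cong₂ _+_ (eq zero) (∑-cong (eq ∘ suc))

∑-zero : ∀ {n} {f : Fin n → ℤ} → (∀ i → f i ≡ + 0) → ∑ f ≡ + 0
∑-zero {zero}  eq = refl
∑-zero {suc n} eq = cong₂ _+_ (eq zero) (∑-zero (eq ∘ suc))

∑≡sum : ∀ {n} (f : Fin n → ℤ) → ∑ f ≡ ℤSum.sum f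
∑≡sum {zero}  f = refl
∑≡sum {suc n} f = cong (_+_ (f zero)) (∑≡sum (f ∘ suc))

∑-distrib-+ : ∀ {n} (f g : Fin n → ℤ) → ∑ (λ i → f i + g i) ≡ ∑ f + ∑ g
∑-distrib-+ f g = begin
  ∑ (λ i → f i + g i)              ≡⟨ ∑≡sum (λ i → f i + g i) ⟩
  ℤSum.sum (λ i → f i + g i)       ≡⟨ ℤSum.∑-distrib-+ f g ⟩
  ℤSum.sum f + ℤSum.sum g          ≡⟨ cong₂ _+_ (∑≡sum f) (∑≡sum g) ⟨
  ∑ f + ∑ g                        ∎
  where open ≡-Reasoning

*-distribˡ-∑ : ∀ {n} (x : ℤ) (f : Fin n → ℤ) → x * ∑ f ≡ ∑ (λ i → x * f i)
*-distribˡ-∑ x f = begin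
  x * ∑ f                    ≡⟨ cong (x *_) (∑≡sum f) ⟩
  x * ℤSum.sum f             ≡⟨ ℤSum.*-distribˡ-sum x f ⟩
  ℤSum.sum (λ i → x * f i)   ≡⟨ ∑≡sum (λ i → x * f i) ⟨
  ∑ (λ i → x * f i)          ∎
  where open ≡-Reasoning

neg-distrib-∑ : ∀ {n} (f : Fin n → ℤ) → - ∑ f ≡ ∑ (λ i → - f i)
neg-distrib-∑ {zero}  f = refl
neg-distrib-∑ {suc n} f = trans (ℤP.neg-distrib-+ (f zero) _) (cong (_+_ (- f zero)) (neg-distrib-∑ (f ∘ suc)))

∑-comm : ∀ {m n} (f : Fin m → Fin n → ℤ) → ∑ (λ i → ∑ (f i)) ≡ ∑ (λ j → ∑ (λ i → f i j))
∑-comm f = begin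
  ∑ (λ i → ∑ (f i))                          ≡⟨ ∑≡sum (λ i → ∑ (f i)) ⟩
  ℤSum.sum (λ i → ∑ (f i))                   ≡⟨ ℤSum.sum-cong-≗ (∑≡sum ∘ f) ⟩
  ℤSum.sum (λ i → ℤSum.sum (f i))            ≡⟨ ℤSum.∑-comm f ⟩
  ℤSum.sum (λ j → ℤSum.sum (λ i → f i j))    ≡⟨ ℤSum.sum-cong-≗ (λ j → ∑≡sum (λ i → f i j)) ⟨
  ℤSum.sum (λ j → ∑ (λ i → f i j))           ≡⟨ ∑≡sum (λ j → ∑ (λ i → f i j)) ⟨
  ∑ (λ j → ∑ (λ i → f i j))                  ∎
  where open ≡-Reasoning

∑-remove : ∀ {n} (f : Fin (suc n) → ℤ) (j : Fin (suc n)) → ∑ f ≡ f j + ∑ (removeAt f j)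
∑-remove f j = begin
  ∑ f                             ≡⟨ ∑≡sum f ⟩
  ℤSum.sum f                      ≡⟨ ℤSum.sum-remove f ⟩
  f j + ℤSum.sum (removeAt f j)   ≡⟨ cong (_+_ (f j)) (∑≡sum (removeAt f j)) ⟨
  f j + ∑ (removeAt f j)          ∎
  where open ≡-Reasoning

∑-single : ∀ {n} (f : Fin n → ℤ) (j : Fin n) → (∀ i → i ≢ j → f i ≡ + 0) → ∑ f ≡ f j
∑-single {suc n} f j others = begin
  ∑ f                       ≡⟨ ∑-remove f j ⟩
  f j + ∑ (removeAt f j)    ≡⟨ cong (_+_ (f j)) (∑-zero (λ k → others _ (FinP.punchInᵢ≢i j k))) ⟩
  f j + + 0                 ≡⟨ ℤP.+-identityʳ (f j) ⟩
  f j                       ∎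
  where open ≡-Reasoning

∷-injective : ∀ {n m} {s : Fin m} {σ : Fin n → Fin m} →
  (∀ c → s ≢ σ c) → Injective _≡_ _≡_ σ → Injective _≡_ _≡_ (s ∷ σ)
∷-injective s∉σ σ-inj {zero}  {zero}  _ = refl
∷-injective s∉σ σ-inj {zero}  {suc c} e = contradiction e (s∉σ c)
∷-injective s∉σ σ-inj {suc c} {zero}  e = contradiction (sym e) (s∉σ c)
∷-injective s∉σ σ-inj {suc c} {suc _} e = cong suc (σ-inj e)

removeAt-injective : ∀ {n m} {ρ : Fin (suc n) → Fin m} →
  Injective _≡_ _≡_ ρ → ∀ p → Injective _≡_ _≡_ (removeAt ρ p)
removeAt-injective ρ-inj p e = FinP.punchIn-injective p _ _ (ρ-inj e)

moveToFront-injective : ∀ {n m} {ρ : Fin (suc n) → Fin m} →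
  Injective _≡_ _≡_ ρ → ∀ p → Injective _≡_ _≡_ (ρ p ∷ removeAt ρ p)
moveToFront-injective ρ-inj p =
  ∷-injective (λ c e → FinP.punchInᵢ≢i p c (sym (ρ-inj e))) (removeAt-injective ρ-inj p)

removeAt-∷ : ∀ {n} {A : Set} (s : A) (σ : Fin (suc n) → A) c k →
  removeAt (s ∷ σ) (suc c) k ≡ (s ∷ removeAt σ c) k
removeAt-∷ s σ c zero    = refl
removeAt-∷ s σ c (suc k) = refl

injective⇒surjective : ∀ {n} {f : Fin n → Fin n} → Injective _≡_ _≡_ f → ∀ y → ∃ λ x → f x ≡ y
injective⇒surjective {suc n} {f} f-inj y with FinP.any? (λ x → f x Fin.≟ y)
... | yes hit = hit
... | no miss = contradiction (FinP.injective⇒≤ punchOut-injective) ℕP.1+n≰n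
  where
  avoids : ∀ x → y ≢ f x
  avoids x y≡fx = miss (x , sym y≡fx)
  punchOut-injective : Injective _≡_ _≡_ (λ x → Fin.punchOut (avoids x))
  punchOut-injective e = f-inj (FinP.punchOut-injective (avoids _) (avoids _) e)

-- punchOut₀ j i is the position of i once j is removed, with the junk value zero when i ≡ j.
punchOut₀ : ∀ {n} → Fin (suc (suc n)) → Fin (suc (suc n)) → Fin (suc n)
punchOut₀ zero    zero    = zero
punchOut₀ zero    (suc i) = i
punchOut₀ (suc j) zero    = zero
punchOut₀ {zero}  (suc j) (suc i) = zero
punchOut₀ {suc n} (suc j) (suc i) = suc (punchOut₀ j i)

punchOut₀-punchIn : ∀ {n} (j : Fin (suc (suc n))) k → punchOut₀ j (punchIn j k) ≡ k
punchOut₀-punchIn zero    k       = refl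
punchOut₀-punchIn (suc j) zero    = refl
punchOut₀-punchIn {suc n} (suc j) (suc k) = cong suc (punchOut₀-punchIn j k)

punchIn-punchOut₀-comm : ∀ {n} (i j : Fin (suc (suc n))) → i ≢ j → ∀ c →
  punchIn j (punchIn (punchOut₀ j i) c) ≡ punchIn i (punchIn (punchOut₀ i j) c)
punchIn-punchOut₀-comm zero    zero    i≢j c = contradiction refl i≢j
punchIn-punchOut₀-comm zero    (suc j) i≢j c = refl
punchIn-punchOut₀-comm (suc i) zero    i≢j c = refl
punchIn-punchOut₀-comm {zero}  (suc zero) (suc zero) i≢j c = contradiction refl i≢j
punchIn-punchOut₀-comm {suc n} (suc i) (suc j) i≢j zero    = refl
punchIn-punchOut₀-comm {suc n} (suc i) (suc j) i≢j (suc c) =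
  cong suc (punchIn-punchOut₀-comm i j (i≢j ∘ cong suc) c)

sgn-punchOut₀ : ∀ {n} (i j : Fin (suc (suc n))) → i ≢ j →
  sgn j * sgn (punchOut₀ j i) ≡ - (sgn i * sgn (punchOut₀ i j))
sgn-punchOut₀ zero    zero    i≢j = contradiction refl i≢j
sgn-punchOut₀ zero    (suc j) i≢j = lemma (sgn j)
  where lemma : ∀ s → - s * + 1 ≡ - (+ 1 * s)
        lemma = solve-∀
sgn-punchOut₀ (suc i) zero    i≢j = lemma (sgn i)
  where lemma : ∀ s → + 1 * s ≡ - (- s * + 1)
        lemma = solve-∀
sgn-punchOut₀ {zero}  (suc zero) (suc zero) i≢j = contradiction refl i≢j
sgn-punchOut₀ {suc n} (suc i) (suc j) i≢j =
  trans (neg*neg (sgn j) _)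
        (trans (sgn-punchOut₀ i j (i≢j ∘ cong suc)) (cong -_ (sym (neg*neg (sgn i) _))))
  where neg*neg : ∀ a b → - a * - b ≡ a * b
        neg*neg = solve-∀

map-insertAt : ∀ {A B : Set} {n} (g : A → B) (xs : Fin n → A) p v →
  ∀ r → g (insertAt xs p v r) ≡ insertAt (g ∘ xs) p (g v) r
map-insertAt g xs zero v zero = refl
map-insertAt g xs zero v (suc r) = refl
map-insertAt {n = suc n} g xs (suc p) v zero = refl
map-insertAt {n = suc n} g xs (suc p) v (suc r) = map-insertAt g (xs ∘ suc) p v r

-- Determinants

Mat : ℕ → ℕ → Set
Mat n m = Fin n → Fin m → ℤ

minor : ∀ {n} → Mat (suc n) (suc n) → Fin (suc n) → Fin (suc n) → Mat n n
minor M i j r c = M (punchIn i r) (punchIn j c)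

det-cong : ∀ {n} {M N : Mat n n} → (∀ r c → M r c ≡ N r c) → det M ≡ det N
det-cong {zero}  eq = refl
det-cong {suc n} eq = ∑-cong λ j →
  cong₂ (λ x y → sgn j * (x * y)) (eq zero j) (det-cong λ r c → eq (suc r) (punchIn j c))

det-expand-col₀ : ∀ {n} (M : Mat (suc n) (suc n)) →
  det M ≡ ∑ (λ i → sgn i * (M i zero * det (minor M i zero)))
det-expand-col₀ {zero}  M = refl
det-expand-col₀ {suc n} M = cong (_+_ (+ 1 * (M zero zero * det (minor M zero zero)))) (begin
    ∑ (λ j → - sgn j * (M zero (suc j) * det (minor M zero (suc j))))
  ≡⟨ ∑-cong (λ j → cong (λ x → - sgn j * (M zero (suc j) * x)) (det-expand-col₀ (minor M zero (suc j)))) ⟩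
    ∑ (λ j → - sgn j * (M zero (suc j) * ∑ (λ i → sgn i * (M (suc i) zero * K i j))))
  ≡⟨ ∑-cong (λ j → pull (- sgn j) (M zero (suc j)) (λ i → sgn i * (M (suc i) zero * K i j))) ⟩
    ∑ (λ j → ∑ (λ i → - sgn j * (M zero (suc j) * (sgn i * (M (suc i) zero * K i j)))))
  ≡⟨ ∑-comm (λ j i → - sgn j * (M zero (suc j) * (sgn i * (M (suc i) zero * K i j)))) ⟩
    ∑ (λ i → ∑ (λ j → - sgn j * (M zero (suc j) * (sgn i * (M (suc i) zero * K i j)))))
  ≡⟨ ∑-cong (λ i → ∑-cong (λ j → exchange (sgn j) (sgn i) (M zero (suc j)) (M (suc i) zero) (K i j))) ⟩
    ∑ (λ i → ∑ (λ j → - sgn i * (M (suc i) zero * (sgn j * (M zero (suc j) * K i j)))))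
  ≡⟨ ∑-cong (λ i → pull (- sgn i) (M (suc i) zero) (λ j → sgn j * (M zero (suc j) * K i j))) ⟨
    ∑ (λ i → - sgn i * (M (suc i) zero * ∑ (λ j → sgn j * (M zero (suc j) * K i j))))
  ∎)
  where
  open ≡-Reasoning
  K : Fin (suc n) → Fin (suc n) → ℤ
  K i j = det (minor (minor M zero zero) i j)
  pull : ∀ {k} (s x : ℤ) (f : Fin k → ℤ) → s * (x * ∑ f) ≡ ∑ (λ i → s * (x * f i))
  pull s x f = trans (cong (s *_) (*-distribˡ-∑ x f)) (*-distribˡ-∑ s (λ i → x * f i))
  exchange : ∀ (sj si a b k : ℤ) → - sj * (a * (si * (b * k))) ≡ - si * (b * (sj * (a * k)))
  exchange = solve-∀

det-transpose : ∀ {n} (M : Mat n n) → det (λ r c → M c r) ≡ det M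
det-transpose {zero}  M = refl
det-transpose {suc n} M =
  trans (∑-cong λ j → cong (λ x → sgn j * (M j zero * x)) (det-transpose (minor M j zero)))
        (sym (det-expand-col₀ M))

∣sgn*∣ : ∀ {n} (i : Fin n) (x : ℤ) → ∣ sgn i * x ∣ ≡ ∣ x ∣
∣sgn*∣ zero    x = cong ∣_∣ (ℤP.*-identityˡ x)
∣sgn*∣ (suc i) x = begin
  ∣ - sgn i * x ∣     ≡⟨ cong ∣_∣ (ℤP.neg-distribˡ-* (sgn i) x) ⟨
  ∣ - (sgn i * x) ∣   ≡⟨ ℤP.∣-i∣≡∣i∣ (sgn i * x) ⟩
  ∣ sgn i * x ∣       ≡⟨ ∣sgn*∣ i x ⟩
  ∣ x ∣               ∎
  where open ≡-Reasoning

infixl 6 _[_]≔_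
_[_]≔_ : ∀ {n m} → Mat n m → Fin n → (Fin m → ℤ) → Mat n m
M [ p ]≔ v = updateAt M p (const v)

minor-≔ : ∀ {n} (M : Mat (suc (suc n)) (suc (suc n))) p v j r c →
  minor (M [ suc p ]≔ v) zero j r c ≡ (minor M zero j [ p ]≔ (v ∘ punchIn j)) r c
minor-≔ M p v j r c =
  cong-app (VecP.map-updateAt-local {f = _∘ punchIn j} {g = const v} (M ∘ suc) p refl r) c

det-≔-cong : ∀ {n} (M : Mat n n) p {v w : Fin n → ℤ} → (∀ c → v c ≡ w c) →
  det (M [ p ]≔ v) ≡ det (M [ p ]≔ w)
det-≔-cong M p {v} {w} v≗w = det-cong cell
  where
  cell : ∀ r c → (M [ p ]≔ v) r c ≡ (M [ p ]≔ w) r c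
  cell r c with r Fin.≟ p
  ... | yes refl = trans (cong-app (VecP.updateAt-updates p M) c)
                         (trans (v≗w c) (sym (cong-app (VecP.updateAt-updates p M) c)))
  ... | no r≢p  = trans (cong-app (VecP.updateAt-minimal r p M r≢p) c)
                        (sym (cong-app (VecP.updateAt-minimal r p M r≢p) c))

det-≔-∑ : ∀ {n ℓ} (M : Mat n n) p (y : Fin ℓ → ℤ) (V : Fin ℓ → Fin n → ℤ) →
  det (M [ p ]≔ (λ c → ∑ (λ x → y x * V x c))) ≡ ∑ (λ x → y x * det (M [ p ]≔ V x))
det-≔-∑ {suc n} M zero y V = begin
    ∑ (λ j → sgn j * (∑ (λ x → y x * V x j) * D j))
  ≡⟨ ∑-cong (λ j → trans (rearrange (sgn j) (∑ (λ x → y x * V x j)) (D j))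
                          (*-distribˡ-∑ (sgn j * D j) (λ x → y x * V x j))) ⟩
    ∑ (λ j → ∑ (λ x → sgn j * D j * (y x * V x j)))
  ≡⟨ ∑-comm (λ j x → sgn j * D j * (y x * V x j)) ⟩
    ∑ (λ x → ∑ (λ j → sgn j * D j * (y x * V x j)))
  ≡⟨ ∑-cong (λ x → trans (∑-cong (λ j → factor (sgn j) (D j) (y x) (V x j)))
                          (sym (*-distribˡ-∑ (y x) (λ j → sgn j * (V x j * D j))))) ⟩
    ∑ (λ x → y x * ∑ (λ j → sgn j * (V x j * D j)))
  ∎
  where
  open ≡-Reasoning
  D : Fin (suc n) → ℤ
  D j = det (minor M zero j)
  rearrange : ∀ s t d → s * (t * d) ≡ s * d * t
  rearrange = solve-∀
  factor : ∀ s d y v → s * d * (y * v) ≡ y * (s * (v * d))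
  factor = solve-∀
det-≔-∑ {suc (suc n)} M (suc p) y V = begin
    ∑ (λ j → sgn j * (M zero j * det (minor (M [ suc p ]≔ S) zero j)))
  ≡⟨ ∑-cong (λ j → cong (λ x → sgn j * (M zero j * x))
        (trans (det-cong (minor-≔ M p S j)) (det-≔-∑ (minor M zero j) p y (λ x → V x ∘ punchIn j)))) ⟩
    ∑ (λ j → sgn j * (M zero j * ∑ (λ x → y x * D x j)))
  ≡⟨ ∑-cong (λ j → trans (cong (sgn j *_) (*-distribˡ-∑ (M zero j) (λ x → y x * D x j)))
                          (*-distribˡ-∑ (sgn j) (λ x → M zero j * (y x * D x j)))) ⟩
    ∑ (λ j → ∑ (λ x → sgn j * (M zero j * (y x * D x j))))
  ≡⟨ ∑-comm (λ j x → sgn j * (M zero j * (y x * D x j))) ⟩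
    ∑ (λ x → ∑ (λ j → sgn j * (M zero j * (y x * D x j))))
  ≡⟨ ∑-cong (λ x → trans (∑-cong (λ j → factor (sgn j) (M zero j) (y x) (D x j)))
        (sym (*-distribˡ-∑ (y x) (λ j → sgn j * (M zero j * D x j))))) ⟩
    ∑ (λ x → y x * ∑ (λ j → sgn j * (M zero j * D x j)))
  ≡⟨ ∑-cong (λ x → cong (y x *_) (∑-cong (λ j → cong (λ z → sgn j * (M zero j * z))
        (sym (det-cong (minor-≔ M p (V x) j)))))) ⟩
    ∑ (λ x → y x * det (M [ suc p ]≔ V x))
  ∎
  where
  open ≡-Reasoning
  S : Fin (suc (suc n)) → ℤ
  S c = ∑ (λ x → y x * V x c)
  D : _ → Fin (suc (suc n)) → ℤ
  D x j = det (minor M zero j [ p ]≔ (V x ∘ punchIn j))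
  factor : ∀ s m y d → s * (m * (y * d)) ≡ y * (s * (m * d))
  factor = solve-∀

∑-offDiagonal-flip : ∀ {n} (f : Fin (suc n) → Fin (suc n) → ℤ) →
  ∑ (λ j → ∑ (λ k → f j (punchIn j k))) ≡ ∑ (λ j → ∑ (λ k → f (punchIn j k) j))
∑-offDiagonal-flip f = ∙-cancelˡ (∑ (λ j → f j j)) _ _ (begin
    ∑ (λ j → f j j) + ∑ (λ j → ∑ (λ k → f j (punchIn j k)))
  ≡⟨ ∑-distrib-+ (λ j → f j j) (λ j → ∑ (λ k → f j (punchIn j k))) ⟨
    ∑ (λ j → f j j + ∑ (λ k → f j (punchIn j k)))
  ≡⟨ ∑-cong (λ j → ∑-remove (f j) j) ⟨
    ∑ (λ j → ∑ (f j))
  ≡⟨ ∑-comm f ⟩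
    ∑ (λ j → ∑ (λ i → f i j))
  ≡⟨ ∑-cong (λ j → ∑-remove (λ i → f i j) j) ⟩
    ∑ (λ j → f j j + ∑ (λ k → f (punchIn j k) j))
  ≡⟨ ∑-distrib-+ (λ j → f j j) (λ j → ∑ (λ k → f (punchIn j k) j)) ⟩
    ∑ (λ j → f j j) + ∑ (λ j → ∑ (λ k → f (punchIn j k) j))
  ∎)
  where open ≡-Reasoning

module _ {n : ℕ} where

  -- The term of the expansion of det M along rows 0 and 1 taking column j from row 0 and
  -- column i from row 1; only i ≢ j is meaningful.
  expansionTerm₀₁ : Mat (suc (suc n)) (suc (suc n)) → Fin (suc (suc n)) → Fin (suc (suc n)) → ℤ
  expansionTerm₀₁ M j i = sgn j * sgn (punchOut₀ j i) * (M zero j * M (suc zero) i)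
    * det (λ r c → M (suc (suc r)) (punchIn j (punchIn (punchOut₀ j i) c)))

  det-expand-rows₀₁ : ∀ (M : Mat (suc (suc n)) (suc (suc n))) →
    det M ≡ ∑ (λ j → ∑ (λ k → expansionTerm₀₁ M j (punchIn j k)))
  det-expand-rows₀₁ M = ∑-cong λ j → trans (pull j) (∑-cong λ k → sym (term j k))
    where
    D : Fin (suc (suc n)) → Fin (suc n) → ℤ
    D j k = det (λ r c → M (suc (suc r)) (punchIn j (punchIn k c)))
    pull : ∀ j → sgn j * (M zero j * ∑ (λ k → sgn k * (M (suc zero) (punchIn j k) * D j k)))
               ≡ ∑ (λ k → sgn j * (M zero j * (sgn k * (M (suc zero) (punchIn j k) * D j k))))
    pull j = trans (cong (sgn j *_) (*-distribˡ-∑ (M zero j) (λ k → sgn k * (M (suc zero) (punchIn j k) * D j k))))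
                   (*-distribˡ-∑ (sgn j) (λ k → M zero j * (sgn k * (M (suc zero) (punchIn j k) * D j k))))
    regroup : ∀ s m₀ s′ m₁ d → s * s′ * (m₀ * m₁) * d ≡ s * (m₀ * (s′ * (m₁ * d)))
    regroup = solve-∀
    term : ∀ j k → expansionTerm₀₁ M j (punchIn j k)
                 ≡ sgn j * (M zero j * (sgn k * (M (suc zero) (punchIn j k) * D j k)))
    term j k rewrite punchOut₀-punchIn j k = regroup (sgn j) (M zero j) (sgn k) (M (suc zero) (punchIn j k)) (D j k)

  swapRows₀₁ : Mat (suc (suc n)) (suc (suc n)) → Mat (suc (suc n)) (suc (suc n))
  swapRows₀₁ M = M (suc zero) ∷ M zero ∷ (λ r → M (suc (suc r)))

  det-swapRows₀₁ : ∀ (M : Mat (suc (suc n)) (suc (suc n))) → det (swapRows₀₁ M) ≡ - det M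
  det-swapRows₀₁ M = begin
      det (swapRows₀₁ M)
    ≡⟨ det-expand-rows₀₁ (swapRows₀₁ M) ⟩
      ∑ (λ j → ∑ (λ k → expansionTerm₀₁ (swapRows₀₁ M) j (punchIn j k)))
    ≡⟨ ∑-offDiagonal-flip (expansionTerm₀₁ (swapRows₀₁ M)) ⟩
      ∑ (λ j → ∑ (λ k → expansionTerm₀₁ (swapRows₀₁ M) (punchIn j k) j))
    ≡⟨ ∑-cong (λ j → ∑-cong (λ k → flipped j k)) ⟩
      ∑ (λ j → ∑ (λ k → - expansionTerm₀₁ M j (punchIn j k)))
    ≡⟨ ∑-cong (λ j → neg-distrib-∑ (λ k → expansionTerm₀₁ M j (punchIn j k))) ⟨
      ∑ (λ j → - ∑ (λ k → expansionTerm₀₁ M j (punchIn j k)))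
    ≡⟨ neg-distrib-∑ (λ j → ∑ (λ k → expansionTerm₀₁ M j (punchIn j k))) ⟨
      - ∑ (λ j → ∑ (λ k → expansionTerm₀₁ M j (punchIn j k)))
    ≡⟨ cong -_ (det-expand-rows₀₁ M) ⟨
      - det M
    ∎
    where
    open ≡-Reasoning
    anticommute : ∀ s a b d → (- s) * (a * b) * d ≡ - (s * (b * a) * d)
    anticommute = solve-∀
    flipped : ∀ j k → expansionTerm₀₁ (swapRows₀₁ M) (punchIn j k) j ≡ - expansionTerm₀₁ M j (punchIn j k)
    flipped j k = trans
      (cong₂ (λ s d → s * (M (suc zero) (punchIn j k) * M zero j) * d)
             (sgn-punchOut₀ j (punchIn j k) j≢)
             (det-cong λ r c → cong (M (suc (suc r))) (punchIn-punchOut₀-comm j (punchIn j k) j≢ c)))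
      (anticommute (sgn j * sgn (punchOut₀ j (punchIn j k))) (M (suc zero) (punchIn j k)) (M zero j)
                   (det (λ r c → M (suc (suc r)) (punchIn j (punchIn (punchOut₀ j (punchIn j k)) c)))))
      where j≢ : j ≢ punchIn j k
            j≢ = FinP.punchInᵢ≢i j k ∘ sym

x≡-x⇒x≡0 : ∀ {x : ℤ} → x ≡ - x → x ≡ + 0
x≡-x⇒x≡0 {x} x≡-x with ℤP.i*j≡0⇒i≡0∨j≡0 (+ 2) 2x≡0
  where
  double : ∀ x → + 2 * x ≡ x + x
  double = solve-∀
  2x≡0 : + 2 * x ≡ + 0
  2x≡0 = trans (double x) (trans (cong (_+_ x) x≡-x) (ℤP.+-inverseʳ x))
... | inj₁ ()
... | inj₂ x≡0 = x≡0

mutual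
  det-equalRows : ∀ {n} (M : Mat n n) {p q} → p ≢ q → (∀ c → M p c ≡ M q c) → det M ≡ + 0
  det-equalRows M {zero}  {zero}  p≢q _  = contradiction refl p≢q
  det-equalRows M {zero}  {suc q} _   eq = det-equalRows₀ M q eq
  det-equalRows M {suc p} {zero}  _   eq = det-equalRows₀ M p (sym ∘ eq)
  det-equalRows M {suc p} {suc q} p≢q eq = det-equalRowsˢ M (p≢q ∘ cong suc) eq

  det-equalRowsˢ : ∀ {n} (M : Mat (suc n) (suc n)) {p q} → p ≢ q →
    (∀ c → M (suc p) c ≡ M (suc q) c) → det M ≡ + 0
  det-equalRowsˢ M p≢q eq = ∑-zero λ j → begin
    sgn j * (M zero j * det (minor M zero j))  ≡⟨ cong (λ x → sgn j * (M zero j * x))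
                                                       (det-equalRows (minor M zero j) p≢q (eq ∘ punchIn j)) ⟩
    sgn j * (M zero j * + 0)                   ≡⟨ cong (sgn j *_) (ℤP.*-zeroʳ (M zero j)) ⟩
    sgn j * + 0                                ≡⟨ ℤP.*-zeroʳ (sgn j) ⟩
    + 0                                        ∎
    where open ≡-Reasoning

  -- Rows 0 and 1 equal: det M = det (swapRows₀₁ M) = - det M.  Otherwise swapping
  -- rows 0 and 1 moves the repeated row below the first.
  det-equalRows₀ : ∀ {n} (M : Mat (suc n) (suc n)) q → (∀ c → M zero c ≡ M (suc q) c) → det M ≡ + 0
  det-equalRows₀ {suc n} M zero eq = x≡-x⇒x≡0 (trans (det-cong swap≗M) (det-swapRows₀₁ M))
    where
    swap≗M : ∀ r c → M r c ≡ swapRows₀₁ M r c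
    swap≗M zero          c = eq c
    swap≗M (suc zero)    c = sym (eq c)
    swap≗M (suc (suc r)) c = refl
  det-equalRows₀ {suc n} M (suc q) eq = ℤP.neg-injective
    (trans (sym (det-swapRows₀₁ M)) (det-equalRowsˢ (swapRows₀₁ M) {zero} {suc q} (λ ()) eq))

det-equalCols : ∀ {n} (M : Mat n n) {p q} → p ≢ q → (∀ r → M r p ≡ M r q) → det M ≡ + 0
det-equalCols M p≢q eq = trans (sym (det-transpose M)) (det-equalRows (λ r c → M c r) p≢q eq)

det-subtractLastRow : ∀ {n} (R : Mat n (suc n)) (x₀ : Fin (suc n) → ℤ) →
  det (insertAt (λ r c → R r c - x₀ c) (fromℕ n) x₀) ≡ det (insertAt R (fromℕ n) x₀)
det-subtractLastRow {zero}  R x₀ = refl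
det-subtractLastRow {suc n} R x₀ = begin
    ∑ (λ j → sgn j * ((R zero j - x₀ j) * det (minor (insertAt (λ r c → R r c - x₀ c) (fromℕ (suc n)) x₀) zero j)))
  ≡⟨ ∑-cong (λ j → trans (cong (λ z → sgn j * ((R zero j - x₀ j) * z)) (minorsAgree j))
                          (distrib (sgn j) (R zero j) (x₀ j) (D j))) ⟩
    ∑ (λ j → sgn j * (R zero j * D j) + - (sgn j * (x₀ j * D j)))
  ≡⟨ ∑-distrib-+ (λ j → sgn j * (R zero j * D j)) (λ j → - (sgn j * (x₀ j * D j))) ⟩
    det (insertAt R (fromℕ (suc n)) x₀) + ∑ (λ j → - (sgn j * (x₀ j * D j)))
  ≡⟨ cong (_+_ (det (insertAt R (fromℕ (suc n)) x₀)))
          (trans (sym (neg-distrib-∑ (λ j → sgn j * (x₀ j * D j)))) (cong -_ x₀-twice)) ⟩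
    det (insertAt R (fromℕ (suc n)) x₀) + - + 0
  ≡⟨ ℤP.+-identityʳ _ ⟩
    det (insertAt R (fromℕ (suc n)) x₀)
  ∎
  where
  open ≡-Reasoning
  D : Fin (suc (suc n)) → ℤ
  D j = det (minor (insertAt R (fromℕ (suc n)) x₀) zero j)
  distrib : ∀ s a b d → s * ((a - b) * d) ≡ s * (a * d) + - (s * (b * d))
  distrib = solve-∀
  restrict : ∀ (X : Mat (suc n) (suc (suc n))) j r c →
    minor (insertAt X (fromℕ (suc n)) x₀) zero j r c
      ≡ insertAt (λ r c → X (suc r) (punchIn j c)) (fromℕ n) (x₀ ∘ punchIn j) r c
  restrict X j r c = cong-app (map-insertAt (_∘ punchIn j) (X ∘ suc) (fromℕ n) x₀ r) c
  minorsAgree : ∀ j → det (minor (insertAt (λ r c → R r c - x₀ c) (fromℕ (suc n)) x₀) zero j) ≡ D j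
  minorsAgree j = trans (det-cong (restrict (λ r c → R r c - x₀ c) j))
    (trans (det-subtractLastRow (λ r c → R (suc r) (punchIn j c)) (x₀ ∘ punchIn j))
           (sym (det-cong (restrict R j))))
  x₀-twice : ∑ (λ j → sgn j * (x₀ j * D j)) ≡ + 0
  x₀-twice = det-equalRows (insertAt (x₀ ∷ (R ∘ suc)) (fromℕ (suc n)) x₀) {zero} {fromℕ (suc n)} (λ ())
    (λ c → sym (cong-app (VecP.insertAt-lookup (x₀ ∷ (R ∘ suc)) (fromℕ (suc n)) x₀) c))

-- Kernels and column bases

cols : ∀ {m n k} → Mat m n → (Fin k → Fin n) → Mat m k
cols N σ r c = N r (σ c)

infix 4 _∈Ker_
_∈Ker_ : ∀ {m n} → (Fin n → ℤ) → Mat m n → Set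
y ∈Ker N = ∀ r → ∑ (λ x → y x * N r x) ≡ + 0

Basis : ∀ {m n} → Mat m n → Set
Basis {m} {n} N = Σ (Fin m → Fin n) λ σ → Injective _≡_ _≡_ σ × det (cols N σ) ≢ + 0

-- Replace row c₀ of the transpose by ∑ₓ y x · (column x of N), which vanishes.  By
-- multilinearity this gives y (σ c₀) · det, since every other term has a repeated row.
det-cols≡0 : ∀ {m ℓ} (N : Mat m ℓ) (σ : Fin m → Fin ℓ) {y : Fin ℓ → ℤ} → y ∈Ker N → NonZeroVec y →
  (∀ x → y x ≢ + 0 → ∃ λ c → σ c ≡ x) → det (cols N σ) ≡ + 0
det-cols≡0 {m} {ℓ} N σ {y} y∈Ker y≢0 supp = trans (sym (det-transpose (cols N σ)))
  ([ (λ e → contradiction e yσc₀≢0) , id ]′ (ℤP.i*j≡0⇒i≡0∨j≡0 (y (σ c₀)) y·det≡0))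
  where
  T : Mat m m
  T c r = N r (σ c)
  nonzero : ∃ λ x → y x ≢ + 0
  nonzero = FinP.¬∀⟶∃¬ ℓ (λ x → y x ≡ + 0) (λ x → y x ℤ.≟ + 0) y≢0
  c₀ : Fin m
  c₀ = proj₁ (supp (proj₁ nonzero) (proj₂ nonzero))
  yσc₀≢0 : y (σ c₀) ≢ + 0
  yσc₀≢0 = subst (λ x → y x ≢ + 0) (sym (proj₂ (supp (proj₁ nonzero) (proj₂ nonzero)))) (proj₂ nonzero)
  vanish : ∀ x → x ≢ σ c₀ → y x * det (T [ c₀ ]≔ (λ r → N r x)) ≡ + 0
  vanish x x≢σc₀ with y x ℤ.≟ + 0
  ... | yes yx≡0 = trans (cong (_* det (T [ c₀ ]≔ (λ r → N r x))) yx≡0)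
                         (ℤP.*-zeroˡ (det (T [ c₀ ]≔ (λ r → N r x))))
  ... | no yx≢0 with supp x yx≢0
  ... | c , σc≡x = trans (cong (y x *_) (det-equalRows _ c₀≢c repeated)) (ℤP.*-zeroʳ (y x))
    where
    c₀≢c : c₀ ≢ c
    c₀≢c c₀≡c = x≢σc₀ (trans (sym σc≡x) (cong σ (sym c₀≡c)))
    repeated : ∀ r → (T [ c₀ ]≔ (λ r → N r x)) c₀ r ≡ (T [ c₀ ]≔ (λ r → N r x)) c r
    repeated r = trans (cong-app (VecP.updateAt-updates c₀ T) r)
      (sym (trans (cong-app (VecP.updateAt-minimal c c₀ T (c₀≢c ∘ sym)) r) (cong (N r) σc≡x)))
  y·det≡0 : y (σ c₀) * det T ≡ + 0
  y·det≡0 = begin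
      y (σ c₀) * det T
    ≡⟨ cong (y (σ c₀) *_) (det-cong λ r c → sym (cong-app (VecP.updateAt-id-local c₀ T refl r) c)) ⟩
      y (σ c₀) * det (T [ c₀ ]≔ (λ r → N r (σ c₀)))
    ≡⟨ ∑-single (λ x → y x * det (T [ c₀ ]≔ (λ r → N r x))) (σ c₀) vanish ⟨
      ∑ (λ x → y x * det (T [ c₀ ]≔ (λ r → N r x)))
    ≡⟨ det-≔-∑ T c₀ y (λ x r → N r x) ⟨
      det (T [ c₀ ]≔ (λ r → ∑ (λ x → y x * N r x)))
    ≡⟨ det-≔-cong T c₀ y∈Ker ⟩
      det (T [ c₀ ]≔ (λ _ → + 0))
    ≡⟨ det-≔-∑ {ℓ = 0} T c₀ (λ ()) (λ ()) ⟩
      + 0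
    ∎
    where open ≡-Reasoning

cofactor : ∀ {n} → Mat n (suc n) → Fin (suc n) → ℤ
cofactor Q p = sgn p * det (λ r c → Q r (punchIn p c))

∑-cofactor : ∀ {n} (Q : Mat n (suc n)) (v : Fin (suc n) → ℤ) →
  ∑ (λ p → cofactor Q p * v p) ≡ det (v ∷ Q)
∑-cofactor Q v = ∑-cong λ p → regroup (sgn p) (det (λ r c → Q r (punchIn p c))) (v p)
  where regroup : ∀ s d x → s * d * x ≡ s * (x * d)
        regroup = solve-∀

cofactor∈Ker : ∀ {n} (Q : Mat n (suc n)) → cofactor Q ∈Ker Q
cofactor∈Ker Q r = trans (∑-cofactor Q (Q r)) (det-equalRows (Q r ∷ Q) {zero} {suc r} (λ ()) (λ c → refl))

basis⊎leftKernel : ∀ {m n} (N : Mat m n) →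
  Basis N ⊎ ∃ λ y → NonZeroVec y × y ∈Ker (λ x r → N r x)
basis⊎leftKernel {zero}  N = inj₁ ((λ ()) , (λ { {()} }) , λ ())
basis⊎leftKernel {suc m} {n} N with basis⊎leftKernel (N ∘ suc)
... | inj₂ (y , y≢0 , y∈Ker) = inj₂ (+ 0 ∷ y , y≢0 ∘ (_∘ suc) , λ x →
        trans (cong (_+ ∑ (λ r → y r * N (suc r) x)) (ℤP.*-zeroˡ (N zero x)))
              (trans (ℤP.+-identityˡ _) (y∈Ker x)))
... | inj₁ (σ , σ-inj , detσ≢0) with FinP.any? (λ x → ¬? (det (cols N (x ∷ σ)) ℤ.≟ + 0))
...   | yes (x , det≢0) = inj₁ (x ∷ σ , ∷-injective x∉σ σ-inj , det≢0)
  where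
  x∉σ : ∀ c → x ≢ σ c
  x∉σ c x≡σc = det≢0 (det-equalCols (cols N (x ∷ σ)) {zero} {suc c} (λ ()) (λ r → cong (N r) x≡σc))
...   | no ¬det≢0 = inj₂ (y , y≢0 , y∈Ker)
  where
  Q : Mat m (suc m)
  Q c r = N r (σ c)
  y : Fin (suc m) → ℤ
  y = cofactor Q
  y≢0 : NonZeroVec y
  y≢0 all0 = detσ≢0 (trans (sym (det-transpose (cols (N ∘ suc) σ)))
                           (trans (sym (ℤP.*-identityˡ _)) (all0 zero)))
  y∈Ker : y ∈Ker (λ x r → N r x)
  y∈Ker x = begin
      ∑ (λ r → y r * N r x)              ≡⟨ ∑-cofactor Q (λ r → N r x) ⟩
      det ((λ r → N r x) ∷ Q)            ≡⟨ det-cong {M = (λ r → N r x) ∷ Q} {N = λ c r → cols N (x ∷ σ) r c} rows ⟩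
      det (λ c r → cols N (x ∷ σ) r c)   ≡⟨ det-transpose (cols N (x ∷ σ)) ⟩
      det (cols N (x ∷ σ))               ≡⟨ decidable-stable (det (cols N (x ∷ σ)) ℤ.≟ + 0) (¬det≢0 ∘ (x ,_)) ⟩
      + 0                                ∎
    where
    open ≡-Reasoning
    rows : ∀ c r → ((λ r → N r x) ∷ Q) c r ≡ cols N (x ∷ σ) r c
    rows zero    r = refl
    rows (suc c) r = refl

independentRows⇒trivialKernel : ∀ {d} (W : Mat d d) → (∀ c → c ∈Ker (λ k r → W r k) → ∀ r → c r ≡ + 0) →
  ∀ {y} → y ∈Ker W → ∀ k → y k ≡ + 0
independentRows⇒trivialKernel W indep {y} y∈Ker k with y k ℤ.≟ + 0
... | yes yk≡0 = yk≡0
... | no  yk≢0 with basis⊎leftKernel W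
...   | inj₂ (c , c≢0 , c∈Ker)       = contradiction (indep c c∈Ker) c≢0
...   | inj₁ (σ , σ-inj , detσ≢0) = contradiction
  (det-cols≡0 W σ {y} y∈Ker (λ all0 → yk≢0 (all0 k)) (λ x _ → injective⇒surjective σ-inj x)) detσ≢0

H : ∀ {d ℓ} → (Fin ℓ → Pt d) → Mat (suc d) ℓ
H a zero    x = + 1
H a (suc k) x = a x k

InZ⇒∈Ker : ∀ {d ℓ} (a : Fin ℓ → Pt d) {u} → InZ a u → u ∈Ker H a
InZ⇒∈Ker a {u} (wt≡0 , _)   zero    = trans (∑-cong λ x → ℤP.*-identityʳ (u x)) wt≡0
InZ⇒∈Ker a     (_ , Au≡0)   (suc k) = Au≡0 k

∈Ker⇒InZ : ∀ {d ℓ} (a : Fin ℓ → Pt d) {u} → u ∈Ker H a → InZ a u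
∈Ker⇒InZ a {u} u∈Ker = trans (∑-cong λ x → sym (ℤP.*-identityʳ (u x))) (u∈Ker zero) , u∈Ker ∘ suc

-- Subtracting the last lifted point from the others clears the row of ones but one entry.
∣det-H∣≡volSimplex : ∀ {d ℓ} (a : Fin ℓ → Pt d) (ρ : Fin (suc d) → Fin ℓ) →
  ∣ det (cols (H a) ρ) ∣ ≡ volSimplex a (ρ (fromℕ d) ∷ removeAt ρ (fromℕ d))
∣det-H∣≡volSimplex {d} a ρ = begin
    ∣ det (cols (H a) ρ) ∣
  ≡⟨ cong ∣_∣ (det-transpose T) ⟩
    ∣ det T ∣
  ≡⟨ cong ∣_∣ (det-cong λ r c → sym (cong-app (VecP.insertAt-removeAt T (fromℕ d) r) c)) ⟩
    ∣ det (insertAt (removeAt T (fromℕ d)) (fromℕ d) (T (fromℕ d))) ∣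
  ≡⟨ cong ∣_∣ (det-subtractLastRow (removeAt T (fromℕ d)) (T (fromℕ d))) ⟨
    ∣ det Y ∣
  ≡⟨ cong ∣_∣ (det-expand-col₀ Y) ⟩
    ∣ ∑ (λ i → sgn i * (Y i zero * det (minor Y i zero))) ∣
  ≡⟨ cong ∣_∣ (∑-single _ (fromℕ d) offLast) ⟩
    ∣ sgn (fromℕ d) * (Y (fromℕ d) zero * det (minor Y (fromℕ d) zero)) ∣
  ≡⟨ ∣sgn*∣ (fromℕ d) _ ⟩
    ∣ Y (fromℕ d) zero * det (minor Y (fromℕ d) zero) ∣
  ≡⟨ cong ∣_∣ (cong₂ _*_ (cong-app (VecP.insertAt-lookup _ (fromℕ d) (T (fromℕ d))) zero) edges) ⟩
    ∣ + 1 * det (λ r c → V c r) ∣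
  ≡⟨ cong ∣_∣ (trans (ℤP.*-identityˡ _) (det-transpose V)) ⟩
    ∣ det V ∣
  ∎
  where
  open ≡-Reasoning
  T : Mat (suc d) (suc d)
  T c r = H a r (ρ c)
  Y : Mat (suc d) (suc d)
  Y = insertAt (λ r c → removeAt T (fromℕ d) r c - T (fromℕ d) c) (fromℕ d) (T (fromℕ d))
  V : Mat d d
  V r c = a (removeAt ρ (fromℕ d) c) r - a (ρ (fromℕ d)) r
  offLast : ∀ i → i ≢ fromℕ d → sgn i * (Y i zero * det (minor Y i zero)) ≡ + 0
  offLast i i≢last = begin
      sgn i * (Y i zero * det (minor Y i zero))
    ≡⟨ cong (λ z → sgn i * (z * det (minor Y i zero))) Yi0≡0 ⟩
      sgn i * (+ 0 * det (minor Y i zero))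
    ≡⟨ cong (sgn i *_) (ℤP.*-zeroˡ (det (minor Y i zero))) ⟩
      sgn i * + 0
    ≡⟨ ℤP.*-zeroʳ (sgn i) ⟩
      + 0
    ∎
    where
    c = Fin.punchOut (i≢last ∘ sym)
    Yi0≡0 : Y i zero ≡ + 0
    Yi0≡0 = trans (cong (λ i → Y i zero) (sym (FinP.punchIn-punchOut (i≢last ∘ sym))))
                  (cong-app (VecP.insertAt-punchIn _ (fromℕ d) (T (fromℕ d)) c) zero)
  edges : det (minor Y (fromℕ d) zero) ≡ det (λ r c → V c r)
  edges = det-cong λ r c → cong-app (VecP.insertAt-punchIn _ (fromℕ d) (T (fromℕ d)) r) (suc c)

cofactor≤Vol†max : ∀ {d ℓ} (a : Fin ℓ → Pt d) {τ : Fin (suc (suc d)) → Fin ℓ} → Injective _≡_ _≡_ τ →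
  ∀ p {n} → n ℕ.≤ ∣ cofactor (cols (H a) τ) p ∣ → n ≤Vol†max a
cofactor≤Vol†max {d} a {τ} τ-inj p n≤ =
  ρ (fromℕ d) ∷ removeAt ρ (fromℕ d) ,
  moveToFront-injective (removeAt-injective τ-inj p) (fromℕ d) ,
  ℕP.≤-trans n≤ (ℕP.≤-reflexive (trans (∣sgn*∣ p _) (∣det-H∣≡volSimplex a ρ)))
  where ρ = removeAt τ p

-- A left kernel vector y of H(A) is an affine functional vanishing on A, so its linear part
-- y ∘ suc vanishes on A − A.
module _ {d ℓ : ℕ} (a : Fin ℓ → Pt d) {y : Fin (suc d) → ℤ} (y∈Ker : y ∈Ker (λ x r → H a r x)) where

  annihilates-differences : ∀ i j → ∑ (λ k → y (suc k) * (a i k - a j k)) ≡ + 0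
  annihilates-differences i j = begin
      ∑ (λ k → y (suc k) * (a i k - a j k))
    ≡⟨ ∑-cong (λ k → distrib (y (suc k)) (a i k) (a j k)) ⟩
      ∑ (λ k → y (suc k) * a i k + - (y (suc k) * a j k))
    ≡⟨ ∑-distrib-+ (λ k → y (suc k) * a i k) (λ k → - (y (suc k) * a j k)) ⟩
      φ i + ∑ (λ k → - (y (suc k) * a j k))
    ≡⟨ cong₂ _+_ φi≡φj (sym (neg-distrib-∑ (λ k → y (suc k) * a j k))) ⟩
      φ j + - φ j
    ≡⟨ ℤP.+-inverseʳ (φ j) ⟩
      + 0
    ∎
    where
    open ≡-Reasoning
    φ : Fin ℓ → ℤ
    φ x = ∑ (λ k → y (suc k) * a x k)
    φi≡φj : φ i ≡ φ j
    φi≡φj = ∙-cancelˡ (y zero * + 1) (φ i) (φ j) (trans (y∈Ker i) (sym (y∈Ker j)))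
    distrib : ∀ s p q → s * (p - q) ≡ s * p + - (s * q)
    distrib = solve-∀

  annihilates-lattice : ∀ {v} → InLattice a v → ∑ (λ k → y (suc k) * v k) ≡ + 0
  annihilates-lattice {v} (c , v≡∑) = begin
      ∑ (λ k → y (suc k) * v k)
    ≡⟨ ∑-cong (λ k → trans (cong (y (suc k) *_) (v≡∑ k)) (distrib k)) ⟩
      ∑ (λ k → ∑ (λ i → ∑ (λ j → y (suc k) * (c i j * (a i k - a j k)))))
    ≡⟨ ∑-comm (λ k i → ∑ (λ j → y (suc k) * (c i j * (a i k - a j k)))) ⟩
      ∑ (λ i → ∑ (λ k → ∑ (λ j → y (suc k) * (c i j * (a i k - a j k)))))
    ≡⟨ ∑-cong (λ i → ∑-comm (λ k j → y (suc k) * (c i j * (a i k - a j k)))) ⟩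
      ∑ (λ i → ∑ (λ j → ∑ (λ k → y (suc k) * (c i j * (a i k - a j k)))))
    ≡⟨ ∑-zero (λ i → ∑-zero (λ j → pair i j)) ⟩
      + 0
    ∎
    where
    open ≡-Reasoning
    distrib : ∀ k → y (suc k) * ∑ (λ i → ∑ (λ j → c i j * (a i k - a j k)))
                  ≡ ∑ (λ i → ∑ (λ j → y (suc k) * (c i j * (a i k - a j k))))
    distrib k = trans (*-distribˡ-∑ (y (suc k)) (λ i → ∑ (λ j → c i j * (a i k - a j k))))
                      (∑-cong λ i → *-distribˡ-∑ (y (suc k)) (λ j → c i j * (a i k - a j k)))
    swap : ∀ s t e → s * (t * e) ≡ t * (s * e)
    swap = solve-∀
    pair : ∀ i j → ∑ (λ k → y (suc k) * (c i j * (a i k - a j k))) ≡ + 0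
    pair i j = begin
      ∑ (λ k → y (suc k) * (c i j * (a i k - a j k)))   ≡⟨ ∑-cong (λ k → swap (y (suc k)) (c i j) (a i k - a j k)) ⟩
      ∑ (λ k → c i j * (y (suc k) * (a i k - a j k)))   ≡⟨ *-distribˡ-∑ (c i j) (λ k → y (suc k) * (a i k - a j k)) ⟨
      c i j * ∑ (λ k → y (suc k) * (a i k - a j k))     ≡⟨ cong (c i j *_) (annihilates-differences i j) ⟩
      c i j * + 0                                       ≡⟨ ℤP.*-zeroʳ (c i j) ⟩
      + 0                                               ∎

basis-H : ∀ {d ℓ} (a : Fin ℓ → Pt d) → LatticeFullDim a → Fin ℓ → Basis (H a)
basis-H a (w , w∈Λ , w-indep) i₀ with basis⊎leftKernel (H a)
... | inj₁ B = B
... | inj₂ (y , y≢0 , y∈Ker) = contradiction allZero y≢0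
  where
  y⁺≡0 : ∀ k → y (suc k) ≡ + 0
  y⁺≡0 = independentRows⇒trivialKernel w w-indep {y ∘ suc} (λ r → annihilates-lattice a {y} y∈Ker (w∈Λ r))
  allZero : ∀ r → y r ≡ + 0
  allZero (suc k) = y⁺≡0 k
  allZero zero    = begin
    y zero                                          ≡⟨ ℤP.*-identityʳ (y zero) ⟨
    y zero * + 1                                    ≡⟨ ℤP.+-identityʳ _ ⟨
    y zero * + 1 + + 0                              ≡⟨ cong (_+_ (y zero * + 1)) (∑-zero y⁺a≡0) ⟨
    y zero * + 1 + ∑ (λ k → y (suc k) * a i₀ k)     ≡⟨ y∈Ker i₀ ⟩
    + 0                                             ∎
    where
    open ≡-Reasoning
    y⁺a≡0 : ∀ k → y (suc k) * a i₀ k ≡ + 0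
    y⁺a≡0 k = trans (cong (_* a i₀ k) (y⁺≡0 k)) (ℤP.*-zeroˡ (a i₀ k))

-- Circuits and basis exchange

δ : ∀ {n} → Fin n → Fin n → ℤ
δ i j with i Fin.≟ j
... | yes _ = + 1
... | no  _ = + 0

δ-refl : ∀ {n} (i : Fin n) → δ i i ≡ + 1
δ-refl i with i Fin.≟ i
... | yes _   = refl
... | no  i≢i = contradiction refl i≢i

δ-≢ : ∀ {n} {i j : Fin n} → i ≢ j → δ i j ≡ + 0
δ-≢ {i = i} {j} i≢j with i Fin.≟ j
... | yes i≡j = contradiction i≡j i≢j
... | no  _   = refl

embed : ∀ {m ℓ} → (Fin m → Fin ℓ) → (Fin m → ℤ) → Fin ℓ → ℤ
embed τ w x = ∑ (λ p → w p * δ (τ p) x)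

embed-image : ∀ {m ℓ} {τ : Fin m → Fin ℓ} → Injective _≡_ _≡_ τ → ∀ w p → embed τ w (τ p) ≡ w p
embed-image {τ = τ} τ-inj w p = begin
  ∑ (λ q → w q * δ (τ q) (τ p))   ≡⟨ ∑-single _ p (λ q q≢p → trans (cong (w q *_) (δ-≢ (q≢p ∘ τ-inj)))
                                                                 (ℤP.*-zeroʳ (w q))) ⟩
  w p * δ (τ p) (τ p)             ≡⟨ cong (w p *_) (δ-refl (τ p)) ⟩
  w p * + 1                       ≡⟨ ℤP.*-identityʳ (w p) ⟩
  w p                             ∎
  where open ≡-Reasoning

embed-outside : ∀ {m ℓ} (τ : Fin m → Fin ℓ) w {x} → (∀ p → τ p ≢ x) → embed τ w x ≡ + 0
embed-outside τ w x∉τ = ∑-zero λ p → trans (cong (w p *_) (δ-≢ (x∉τ p))) (ℤP.*-zeroʳ (w p))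

embed∈Ker : ∀ {m n ℓ} (N : Mat n ℓ) (τ : Fin m → Fin ℓ) w → w ∈Ker cols N τ → embed τ w ∈Ker N
embed∈Ker N τ w w∈Ker r = begin
    ∑ (λ x → ∑ (λ p → w p * δ (τ p) x) * N r x)
  ≡⟨ ∑-cong (λ x → trans (ℤP.*-comm _ (N r x)) (*-distribˡ-∑ (N r x) (λ p → w p * δ (τ p) x))) ⟩
    ∑ (λ x → ∑ (λ p → N r x * (w p * δ (τ p) x)))
  ≡⟨ ∑-comm (λ x p → N r x * (w p * δ (τ p) x)) ⟩
    ∑ (λ p → ∑ (λ x → N r x * (w p * δ (τ p) x)))
  ≡⟨ ∑-cong (λ p → ∑-single _ (τ p) (λ x x≢τp → trans (cong (λ z → N r x * (w p * z)) (δ-≢ (x≢τp ∘ sym)))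
                                                  (trans (cong (N r x *_) (ℤP.*-zeroʳ (w p))) (ℤP.*-zeroʳ (N r x))))) ⟩
    ∑ (λ p → N r (τ p) * (w p * δ (τ p) (τ p)))
  ≡⟨ ∑-cong (λ p → trans (cong (λ z → N r (τ p) * (w p * z)) (δ-refl (τ p)))
                          (trans (cong (N r (τ p) *_) (ℤP.*-identityʳ (w p))) (ℤP.*-comm (N r (τ p)) (w p)))) ⟩
    ∑ (λ p → w p * N r (τ p))
  ≡⟨ w∈Ker r ⟩
    + 0
  ∎
  where open ≡-Reasoning

-- By minimality of the circuit u, such a v is a nonzero multiple of u.
circuit-≤ : ∀ {d ℓ} (a : Fin ℓ → Pt d) {u v} → InZdagger a u →
  InZ a v → NonZeroVec v → SuppSubset v u → ∀ i → ∣ u i ∣ ℕ.≤ ∣ v i ∣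
circuit-≤ a {u} {v} (_ , _ , circuit) v∈Z v≢0 v⊆u i with circuit v v∈Z v≢0 v⊆u
... | λ′ , v≡λ′u = ℕP.≤-trans (≤∣λ′∣* ∣ λ′ ∣ refl)
                             (ℕP.≤-reflexive (trans (sym (ℤP.abs-* λ′ (u i))) (cong ∣_∣ (sym (v≡λ′u i)))))
  where
  ≤∣λ′∣* : ∀ k → ∣ λ′ ∣ ≡ k → ∣ u i ∣ ℕ.≤ k ℕ.* ∣ u i ∣
  ≤∣λ′∣* (suc k) _      = ℕP.m≤n*m ∣ u i ∣ (suc k)
  ≤∣λ′∣* zero    ∣λ′∣≡0 = contradiction (λ j → trans (v≡λ′u j) (0*u≡0 j)) v≢0
    where
    0*u≡0 : ∀ j → λ′ * u j ≡ + 0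
    0*u≡0 j = trans (cong (_* u j) (ℤP.∣i∣≡0⇒i≡0 {λ′} ∣λ′∣≡0)) (ℤP.*-zeroˡ (u j))

isZero : ℤ → ℕ
isZero (+ zero) = 1
isZero _        = 0

isZero-≢0 : ∀ {x} → x ≢ + 0 → isZero x ≡ 0
isZero-≢0 {+ zero}   x≢0 = contradiction refl x≢0
isZero-≢0 {+ suc _}  _   = refl
isZero-≢0 { -[1+ _ ]} _  = refl

module _ {d ℓ : ℕ} (a : Fin ℓ → Pt d) {u : Fin ℓ → ℤ} (u† : InZdagger a u) where

  private
    u∈Ker : u ∈Ker H a
    u∈Ker = InZ⇒∈Ker a (proj₁ u†)

  kernelVector-bound : ∀ {k} {τ : Fin (suc k) → Fin ℓ} → Injective _≡_ _≡_ τ →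
    ∀ {w} → w ∈Ker cols (H a) τ → NonZeroVec w → (∀ p → u (τ p) ≡ + 0 → w p ≡ + 0) →
    (∀ p {n} → n ℕ.≤ ∣ w p ∣ → n ≤Vol†max a) → ∀ i → ∣ u i ∣ ≤Vol†max a
  kernelVector-bound {τ = τ} τ-inj {w} w∈Ker w≢0 w⊆u volume i = boundAt (FinP.any? (λ p → τ p Fin.≟ i))
    where
    W : Fin ℓ → ℤ
    W = embed τ w
    W⊆u : SuppSubset W u
    W⊆u x Wx≢0 with FinP.any? (λ p → τ p Fin.≟ x)
    ... | yes (p , refl) = λ ux≡0 → Wx≢0 (trans (embed-image τ-inj w p) (w⊆u p ux≡0))
    ... | no  x∉τ        = contradiction (embed-outside τ w (λ p → x∉τ ∘ (p ,_))) Wx≢0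
    ∣u∣≤∣W∣ : ∀ x → ∣ u x ∣ ℕ.≤ ∣ W x ∣
    ∣u∣≤∣W∣ = circuit-≤ a u† (∈Ker⇒InZ a (embed∈Ker (H a) τ w w∈Ker))
                (λ all0 → w≢0 (λ p → trans (sym (embed-image τ-inj w p)) (all0 (τ p)))) W⊆u
    boundAt : Dec (∃ λ p → τ p ≡ i) → ∣ u i ∣ ≤Vol†max a
    boundAt (yes (p , refl)) =
      volume p (subst (λ z → ∣ u (τ p) ∣ ℕ.≤ ∣ z ∣) (embed-image τ-inj w p) (∣u∣≤∣W∣ (τ p)))
    boundAt (no i∉τ)         = volume zero (ℕP.≤-trans (∣u∣≤∣W∣ i)
      (subst (ℕ._≤ ∣ w zero ∣) (sym (cong ∣_∣ (embed-outside τ w (λ p → i∉τ ∘ (p ,_))))) z≤n))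

  zeroCount : (Fin (suc d) → Fin ℓ) → ℕ
  zeroCount σ = ℕSum.sum (λ c → isZero (u (σ c)))

  zeroCount-exchange : ∀ (σ : Fin (suc d) → Fin ℓ) {s} c → u (σ c) ≡ + 0 → u s ≢ + 0 →
    zeroCount (s ∷ removeAt σ c) ℕ.< zeroCount σ
  zeroCount-exchange σ {s} c uσc≡0 us≢0 = begin-strict
    isZero (u s) ℕ.+ rest      ≡⟨ cong (ℕ._+ rest) (isZero-≢0 us≢0) ⟩
    rest                       <⟨ ℕP.n<1+n rest ⟩
    suc rest                   ≡⟨ cong (λ z → isZero z ℕ.+ rest) uσc≡0 ⟨
    isZero (u (σ c)) ℕ.+ rest  ≡⟨ ℕSum.sum-remove (λ c → isZero (u (σ c))) ⟨
    zeroCount σ                ∎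
    where
    open ℕP.≤-Reasoning
    rest = ℕSum.sum (removeAt (λ c → isZero (u (σ c))) c)

  outsideBasis : ((σ , _) : Basis (H a)) → ∃ λ s → u s ≢ + 0 × (∀ c → s ≢ σ c)
  outsideBasis (σ , _ , detσ≢0) with FinP.any? (λ s → ¬? (u s ℤ.≟ + 0) ×-dec FinP.all? (λ c → ¬? (s Fin.≟ σ c)))
  ... | yes found = found
  ... | no  none  = contradiction (det-cols≡0 (H a) σ {u} u∈Ker (proj₁ (proj₂ u†)) inImage) detσ≢0
    where
    inImage : ∀ x → u x ≢ + 0 → ∃ λ c → σ c ≡ x
    inImage x ux≢0 with FinP.any? (λ c → σ c Fin.≟ x)
    ... | yes hit  = hit
    ... | no  miss = contradiction (x , ux≢0 , λ c x≡σc → miss (c , sym x≡σc)) none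

  -- The cofactors w of the columns s ∷ σ form a kernel vector of H(A) with w 0 = det σ ≢ 0.
  -- Either w is nonzero at some σ c off the support of u, and σ c can be exchanged for s,
  -- or w is supported inside the support of u.
  exchange : (B : Basis (H a)) → ∀ {s} → u s ≢ + 0 → (∀ c → s ≢ proj₁ B c) →
    (Σ (Basis (H a)) λ B′ → zeroCount (proj₁ B′) ℕ.< zeroCount (proj₁ B)) ⊎ (∀ i → ∣ u i ∣ ≤Vol†max a)
  exchange (σ , σ-inj , detσ≢0) {s} us≢0 s∉σ =
    decide (FinP.any? (λ c → (u (σ c) ℤ.≟ + 0) ×-dec ¬? (w (suc c) ℤ.≟ + 0)))
    where
    τ : Fin (suc (suc d)) → Fin ℓ
    τ = s ∷ σ
    w : Fin (suc (suc d)) → ℤ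
    w = cofactor (cols (H a) τ)
    decide : Dec (∃ λ c → u (σ c) ≡ + 0 × w (suc c) ≢ + 0) →
      (Σ (Basis (H a)) λ B′ → zeroCount (proj₁ B′) ℕ.< zeroCount σ) ⊎ (∀ i → ∣ u i ∣ ≤Vol†max a)
    decide (yes (c , uσc≡0 , wc≢0)) =
      inj₁ ((s ∷ removeAt σ c , ∷-injective (s∉σ ∘ punchIn c) (removeAt-injective σ-inj c) , det≢0) ,
            zeroCount-exchange σ c uσc≡0 us≢0)
      where
      det≢0 : det (cols (H a) (s ∷ removeAt σ c)) ≢ + 0
      det≢0 det≡0 = wc≢0 (trans (cong (sgn (suc c) *_) (trans (det-cong λ r k → cong (H a r) (removeAt-∷ s σ c k))
                                                                det≡0))
                                (ℤP.*-zeroʳ (sgn (suc c))))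
    decide (no ¬exchangeable) =
      inj₂ (kernelVector-bound τ-inj (cofactor∈Ker (cols (H a) τ)) w≢0 w⊆u (cofactor≤Vol†max a τ-inj))
      where
      τ-inj : Injective _≡_ _≡_ τ
      τ-inj = ∷-injective s∉σ σ-inj
      w≢0 : NonZeroVec w
      w≢0 all0 = detσ≢0 (trans (sym (ℤP.*-identityˡ _)) (all0 zero))
      w⊆u : ∀ p → u (τ p) ≡ + 0 → w p ≡ + 0
      w⊆u zero    us≡0   = contradiction us≡0 us≢0
      w⊆u (suc c) uσc≡0 with w (suc c) ℤ.≟ + 0
      ... | yes wc≡0 = wc≡0
      ... | no  wc≢0 = contradiction (c , uσc≡0 , wc≢0) ¬exchangeable

  ∣u∣≤Vol†max : (B : Basis (H a)) → Acc ℕ._<_ (zeroCount (proj₁ B)) → ∀ i → ∣ u i ∣ ≤Vol†max a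
  ∣u∣≤Vol†max B (acc more) with outsideBasis B
  ... | s , us≢0 , s∉σ with exchange B us≢0 s∉σ
  ...   | inj₁ (B′ , fewer) = ∣u∣≤Vol†max B′ (more fewer)
  ...   | inj₂ bound        = bound

mainTheorem4 : ∀ {d ℓ : ℕ} (a : Fin ℓ → Pt d) → Injective _≡_ _≡_ a →
    LatticeFullDim a → (u : Fin ℓ → ℤ) → InZdagger a u →
    ∀ (i : Fin ℓ) → ∣ u i ∣ ≤Vol†max a
mainTheorem4 a _ fullDim u u† i = ∣u∣≤Vol†max a u† B (<-wellFounded (zeroCount a u† (proj₁ B))) i
  where B = basis-H a fullDim i
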